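{- Let $T\ge1$, $\mathcal{T}=\{1,\dots,T\}$, and let $A_0,\dots,A_T$ and $B_0,\dots,B_T$ be integer sequences that each satisfy $Z_0=0$ and $Z_{t-1}\le Z_t\le Z_{t-1}+1$ for all $t\in\mathcal{T}$. Then there exist $x_1,\dots,x_T\in\{0,1\}$ with $A_t\le \sum_{i=1}^t x_i\le B_t$ for all $t\in\mathcal{T}$ if and only if $A_t\le B_t$ for every $t\in\mathcal{T}$. -}

module Defs where

open import Data.Nat using (ℕ; zero; suc) renaming (_≤_ to _≤ℕ_)
open import Data.Integer using (ℤ; _+_; _≤_; 0ℤ; 1ℤ)
open import Data.Product using (_×_)
open import Relation.Binary.PropositionalEquality using (_≡_)

partialSum : (ℕ → ℤ) → ℕ → ℤ
partialSum x zero    = 0ℤ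
partialSum x (suc t) = partialSum x t + x (suc t)

Admissible : ℕ → (ℕ → ℤ) → Set
Admissible T Z =
  (Z 0 ≡ 0ℤ) × (∀ t → 1 ≤ℕ t → t ≤ℕ T → (Z (t Data.Nat.∸ 1) ≤ Z t) × (Z t ≤ Z (t Data.Nat.∸ 1) + 1ℤ))
  where import Data.Nat

-- For sufficiency, take x to be the increments of the
-- lower sequence A: they lie in {0,1} because A moves by unit steps, and their partial
-- sums telescope back to A, which lies between A and B.
module Submission where

open import Defs
open import Data.Nat using (ℕ; zero; suc; _∸_; s≤s) renaming (_≤_ to _≤ℕ_)
open import Data.Integer using (ℤ; _≤_; 0ℤ; 1ℤ; _+_; _-_; -_; +_; -[1+_]; +≤+)
open import Data.Integer.Properties
  using (≤-refl; ≤-trans; +-comm; +-identityʳ; +-inverseʳ; +-minus-telescope;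
         +-monoˡ-≤; i≤j⇒0≤j-i; +-0-abelianGroup)
open import Algebra.Properties.AbelianGroup +-0-abelianGroup using (xyx⁻¹≈y)
open import Data.Product using (_×_; ∃-syntax; _,_)
open import Data.Sum using (_⊎_; inj₁; inj₂)
open import Function.Bundles using (_⇔_; mk⇔)
open import Relation.Binary.PropositionalEquality using (_≡_; refl; sym; cong; subst)
open Relation.Binary.PropositionalEquality.≡-Reasoning

BinaryOn : ℕ → (ℕ → ℤ) → Set
BinaryOn T x = ∀ i → 1 ≤ℕ i → i ≤ℕ T → x i ≡ 0ℤ ⊎ x i ≡ 1ℤ

SandwichedOn : ℕ → (ℕ → ℤ) → (ℕ → ℤ) → (ℕ → ℤ) → Set
SandwichedOn T A B Z = ∀ t → 1 ≤ℕ t → t ≤ℕ T → (A t ≤ Z t) × (Z t ≤ B t)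

increments : (ℕ → ℤ) → ℕ → ℤ
increments Z i = Z i - Z (i ∸ 1)

partialSum-increments : ∀ Z t → partialSum (increments Z) t ≡ Z t - Z 0
partialSum-increments Z zero    = sym (+-inverseʳ (Z 0))
partialSum-increments Z (suc t) = begin
  partialSum (increments Z) t + increments Z (suc t) ≡⟨ cong (_+ increments Z (suc t)) (partialSum-increments Z t) ⟩
  (Z t - Z 0) + (Z (suc t) - Z t)                    ≡⟨ +-comm (Z t - Z 0) _ ⟩
  (Z (suc t) - Z t) + (Z t - Z 0)                    ≡⟨ +-minus-telescope (Z (suc t)) (Z t) (Z 0) ⟩
  Z (suc t) - Z 0                                    ∎

0≤i≤1⇒i≡0⊎i≡1 : ∀ {i} → 0ℤ ≤ i → i ≤ 1ℤ → i ≡ 0ℤ ⊎ i ≡ 1ℤ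
0≤i≤1⇒i≡0⊎i≡1 {+ 0}           _ _                  = inj₁ refl
0≤i≤1⇒i≡0⊎i≡1 {+ 1}           _ _                  = inj₂ refl
0≤i≤1⇒i≡0⊎i≡1 {+ suc (suc _)} _ (+≤+ (s≤s ()))
0≤i≤1⇒i≡0⊎i≡1 { -[1+ _ ]}     () _

i≤j≤i+1⇒j-i≡0⊎j-i≡1 : ∀ {i j} → i ≤ j → j ≤ i + 1ℤ → j - i ≡ 0ℤ ⊎ j - i ≡ 1ℤ
i≤j≤i+1⇒j-i≡0⊎j-i≡1 {i} {j} i≤j j≤i+1 =
  0≤i≤1⇒i≡0⊎i≡1 (i≤j⇒0≤j-i i≤j) (subst (j - i ≤_) (xyx⁻¹≈y i 1ℤ) (+-monoˡ-≤ (- i) j≤i+1))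

lemma1 : (T : ℕ) → 1 ≤ℕ T → (A B : ℕ → ℤ) → Admissible T A → Admissible T B →
    (∃[ x ] ((∀ i → 1 ≤ℕ i → i ≤ℕ T → (x i ≡ 0ℤ ⊎ x i ≡ 1ℤ))
             × (∀ t → 1 ≤ℕ t → t ≤ℕ T → (A t ≤ partialSum x t) × (partialSum x t ≤ B t))))
    ⇔ (∀ t → 1 ≤ℕ t → t ≤ℕ T → A t ≤ B t)
-- Only the lower sequence needs to be admissible.
lemma1 T _ A B (A0≡0 , A-steps) _ = mk⇔ sandwiched⇒A≤B A≤B⇒sandwiched
  where
  sandwiched⇒A≤B : ∃[ x ] (BinaryOn T x × SandwichedOn T A B (partialSum x)) → ∀ t → 1 ≤ℕ t → t ≤ℕ T → A t ≤ B t
  sandwiched⇒A≤B (_ , _ , sandwich) t 1≤t t≤T with sandwich t 1≤t t≤T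
  ... | A≤Σx , Σx≤B = ≤-trans A≤Σx Σx≤B

  partialSum-increments-A : ∀ t → partialSum (increments A) t ≡ A t
  partialSum-increments-A t = begin
    partialSum (increments A) t ≡⟨ partialSum-increments A t ⟩
    A t - A 0                   ≡⟨ cong (λ a → A t - a) A0≡0 ⟩
    A t + 0ℤ                    ≡⟨ +-identityʳ (A t) ⟩
    A t                         ∎

  A≤B⇒sandwiched : (∀ t → 1 ≤ℕ t → t ≤ℕ T → A t ≤ B t)
                 → ∃[ x ] (BinaryOn T x × SandwichedOn T A B (partialSum x))
  A≤B⇒sandwiched A≤B = increments A , binary , sandwich
    where
    binary : BinaryOn T (increments A)
    binary i 1≤i i≤T with A-steps i 1≤i i≤T
    ... | below , above = i≤j≤i+1⇒j-i≡0⊎j-i≡1 below above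

    sandwich : SandwichedOn T A B (partialSum (increments A))
    sandwich t 1≤t t≤T rewrite partialSum-increments-A t = ≤-refl , A≤B t 1≤t t≤T
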